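{- Let $n\ge1$, $k\ge0$ and $0\le i<CC^{n}_{k}$. The procedure $\textsc{FindMultiset}(n,k,i)$ described in the context returns the $i$-th (zero-based) multiset among the multisets consisting of $k$ elements from the integers $0,\dots,n-1$, in $O(k^2\log n)$ time.
   Context: For integers $a\ge0,k\ge0$, $CC^{a}_{k}=\binom{a-1+k}{k}$, the number of multisets of $k$ elements from an $a$-element set. A multiset of $k$ integers is represented by the length-$k$ sequence of its elements in non-increasing order, and multisets are ordered lexicographically by these sequences; indices are zero-based. Procedure $\textsc{FindMultiset}(n,k,i)$: if $n=1$ or $k=0$, return the multiset consisting of $k$ zeros; otherwise let $\ell$ be the largest integer (in $\{0,\dots,n-1\}$) such that $CC^{\ell}_{k}\le i$, let $\bar S=\textsc{FindMultiset}(\ell+1,k-1,i-CC^{\ell}_{k})$, and return $\{\ell\}\uplus\bar S$. Each arithmetic operation on integers counts as one time step. -}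

module Defs where

open import Data.Nat using (ℕ; zero; suc; _+_; _*_; _∸_; _/_; _<_; _≥_; _≤ᵇ_; _≡ᵇ_)
open import Data.Nat.Properties using (_≟_; _<?_; _≥?_)
open import Data.Nat.Combinatorics using (_C_)
open import Data.Bool using (if_then_else_)
open import Data.Product using (_×_; _,_; proj₁; proj₂)
open import Data.List using (List; []; _∷_; [_]; length; map; concatMap; upTo; filter; replicate)
open import Data.List.Relation.Unary.All using (All)
open import Data.List.Relation.Unary.Linked using (Linked; linked?)
open import Data.List.Relation.Binary.Lex.Strict using (Lex-<; <-decidable)
open import Relation.Binary.PropositionalEquality using (_≡_)
open import Relation.Nullary using (Dec)

-- CC^a_k = binom(a-1+k, k): number of k-multisets from an a-set.
-- (For a = 0: binom(k-1,k) = 1 if k = 0, else 0.)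

CC : ℕ → ℕ → ℕ
CC zero    zero    = 1
CC zero    (suc k) = 0
CC (suc a) k       = (a + k) C k

-- Multisets of k elements from {0,…,n-1}, represented by their
-- non-increasing sequence of elements.

IsMultiset : ℕ → ℕ → List ℕ → Set
IsMultiset n k xs = (length xs ≡ k) × (All (_< n) xs × Linked _≥_ xs)

_<lex_ : List ℕ → List ℕ → Set
_<lex_ = Lex-< _≡_ _<_

_<lex?_ : (xs ys : List ℕ) → Dec (xs <lex ys)
_<lex?_ = <-decidable _≟_ _<?_

allSeqs : ℕ → ℕ → List (List ℕ)
allSeqs n zero    = [ [] ]
allSeqs n (suc k) = concatMap (λ x → map (x ∷_) (allSeqs n k)) (upTo n)

multisets : ℕ → ℕ → List (List ℕ)
multisets n k = filter (linked? _≥?_) (allSeqs n k)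

index : ℕ → ℕ → List ℕ → ℕ
index n k S = length (filter (λ T → T <lex? S) (multisets n k))

-- Cost-instrumented implementation of FindMultiset.
-- Every function returns (result , number of arithmetic operations),
-- where each arithmetic operation / comparison counts as one step.

-- Computing CC^(a+1)_k = binom(a+k,k) iteratively:
-- c₀ = 1, c_j = c_{j-1} * (a + j) / j for j = 1..k.
-- Each iteration: a + j, *, /, j+1, loop test  (5 steps); final loop test (1).
ccLoop : (a r j c : ℕ) → ℕ × ℕ          -- r iterations left, next index is suc j
ccLoop a zero    j c = c , 1
ccLoop a (suc r) j c =
  let res = ccLoop a r (suc j) ((c * (a + suc j)) / suc j)
  in proj₁ res , 5 + proj₂ res

-- CC^a_k with cost (one test for a = 0, one for k = 0).
CCc : ℕ → ℕ → ℕ × ℕ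
CCc zero    zero    = 1 , 2
CCc zero    (suc k) = 0 , 2
CCc (suc a) k       = let res = ccLoop a k zero 1 in proj₁ res , 1 + proj₂ res

-- Binary search for the largest ℓ in [lo, hi) with CC^ℓ_k ≤ i
-- (invariant: CC^lo_k ≤ i, and hi is either n or has CC^hi_k > i).
-- The fuel argument only ensures termination; n is enough fuel.
bsearch : (fuel k i lo hi : ℕ) → ℕ × ℕ
bsearch zero     k i lo hi = lo , 1
bsearch (suc f)  k i lo hi =
  if (hi ∸ lo) ≤ᵇ 1
  then (lo , 2)
  else (let mid = (lo + hi) / 2
            c   = CCc mid k
            rec = if proj₁ c ≤ᵇ i
                  then bsearch f k i mid hi
                  else bsearch f k i lo mid
        in proj₁ rec , 2 + 2 + proj₂ c + 1 + proj₂ rec)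

findMultisetC : (n k i : ℕ) → List ℕ × ℕ
findMultisetC n zero    i = [] , 2
findMultisetC n (suc k) i =
  if n ≡ᵇ 1
  then (replicate (suc k) 0 , 2)
  else (let ℓ   = bsearch n (suc k) i 0 n
            c   = CCc (proj₁ ℓ) (suc k)
            rec = findMultisetC (suc (proj₁ ℓ)) k (i ∸ proj₁ c)
        in (proj₁ ℓ ∷ proj₁ rec) , 2 + proj₂ ℓ + proj₂ c + 1 + proj₂ rec)

FindMultiset : (n k i : ℕ) → List ℕ
FindMultiset n k i = proj₁ (findMultisetC n k i)

steps : (n k i : ℕ) → ℕ
steps n k i = proj₂ (findMultisetC n k i)

{-# OPTIONS --safe #-}
module Submission where

-- Listed lexicographically, the k-multisets over {0,…,n-1} (k ≥ 1) fall into consecutive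
-- blocks ℓ ∷ T, ℓ = 0,…,n-1, where T runs through the (k-1)-multisets over {0,…,ℓ}; by
-- Pascal's rule the blocks before ℓ hold CC ℓ k multisets in total. So the i-th multiset
-- starts with the ℓ satisfying CC ℓ k ≤ i < CC (ℓ+1) k and continues with the
-- (i - CC ℓ k)-th (k-1)-multiset over {0,…,ℓ}. Binary search finds ℓ with O(log n)
-- evaluations of CC, each O(k) steps, and there are k levels of recursion.

open import Defs
open import Data.Nat
open import Data.Bool using (true; false)
open import Data.Nat.Properties
open import Data.Nat.Combinatorics using (_C_; nCn≡1; nC1≡n; nCk+nC[k+1]≡[n+1]C[k+1])
open import Data.Nat.DivMod using (m*n/n≡m; m/n≡1+[m∸n]/n)
open import Data.Nat.Tactic.RingSolver using (solve-∀)
open import Data.Nat.Logarithm using (⌈log₂_⌉; ⌈log₂⌉-mono-≤; ⌈log₂⌈n/2⌉⌉≡⌈log₂n⌉∸1)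
open import Data.List using (List; []; _∷_; [_]; _++_; length; map; concatMap; upTo; filter; replicate)
open import Data.List.Properties using (filter-++; filter-≐; filter-all; filter-none; concatMap-++; upTo-∷ʳ; ++-identityʳ; length-++; length-map)
open import Data.List.Relation.Unary.All as All using (All; []; _∷_; all?; universal)
open import Data.List.Relation.Unary.Linked as Linked using (Linked; []; [-]; _∷_; linked?)
open import Data.List.Relation.Unary.Linked.Properties using (Linked⇒All)
open import Data.List.Relation.Binary.Lex.Strict using (this; next)
open import Data.Product using (Σ; _×_; _,_; proj₁; proj₂)
open import Function using (_∘_)
open import Relation.Nullary using (does; contradiction; ofʸ; ofⁿ)
open import Relation.Unary using (Pred; Decidable; _≐_; _∩_)
open import Relation.Unary.Properties using (_∩?_)
open import Relation.Binary.PropositionalEquality hiding ([_])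

[1+k]*[1+n]C[1+k]≡[1+n]*nCk : ∀ n k → suc k * (suc n C suc k) ≡ suc n * (n C k)
[1+k]*[1+n]C[1+k]≡[1+n]*nCk zero    zero    = refl
[1+k]*[1+n]C[1+k]≡[1+n]*nCk zero    (suc k) = *-zeroʳ (suc (suc k))
[1+k]*[1+n]C[1+k]≡[1+n]*nCk (suc n) zero    = trans (+-identityʳ _) (trans (nC1≡n (suc (suc n))) (sym (*-identityʳ _)))
[1+k]*[1+n]C[1+k]≡[1+n]*nCk (suc n) (suc k) = begin
    suc (suc k) * (suc (suc n) C suc (suc k))
  ≡⟨ cong (suc (suc k) *_) (sym (nCk+nC[k+1]≡[n+1]C[k+1] (suc n) (suc k))) ⟩
    suc (suc k) * (A + B)
  ≡⟨ distribute A B k ⟩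
    A + suc k * A + suc (suc k) * B
  ≡⟨ cong₂ (λ u v → A + u + v) ([1+k]*[1+n]C[1+k]≡[1+n]*nCk n k) ([1+k]*[1+n]C[1+k]≡[1+n]*nCk n (suc k)) ⟩
    A + suc n * (n C k) + suc n * (n C suc k)
  ≡⟨ collect A (n C k) (n C suc k) n ⟩
    A + suc n * (n C k + n C suc k)
  ≡⟨ cong (λ u → A + suc n * u) (nCk+nC[k+1]≡[n+1]C[k+1] n k) ⟩
    A + suc n * A
  ≡⟨ solve-∀ ⟩
    suc (suc n) * A ∎
  where
    open ≡-Reasoning
    A = suc n C suc k
    B = suc n C suc (suc k)
    distribute : ∀ a b j → suc (suc j) * (a + b) ≡ a + suc j * a + suc (suc j) * b
    distribute = solve-∀
    collect : ∀ a b c m → a + suc m * b + suc m * c ≡ a + suc m * (b + c)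
    collect = solve-∀

CC-pascal : ∀ a k → CC (suc a) (suc k) ≡ CC a (suc k) + CC (suc a) k
CC-pascal zero    k = trans (nCn≡1 (suc k)) (sym (nCn≡1 k))
CC-pascal (suc a) k = begin
    suc (a + suc k) C suc k
  ≡⟨ sym (nCk+nC[k+1]≡[n+1]C[k+1] (a + suc k) k) ⟩
    (a + suc k) C k + (a + suc k) C suc k
  ≡⟨ +-comm ((a + suc k) C k) _ ⟩
    (a + suc k) C suc k + (a + suc k) C k
  ≡⟨ cong (λ m → (a + suc k) C suc k + m C k) (+-suc a k) ⟩
    (a + suc k) C suc k + suc (a + k) C k ∎
  where open ≡-Reasoning

[nCk*[1+n]]/[1+k]≡[1+n]C[1+k] : ∀ n k → ((n C k) * suc n) / suc k ≡ suc n C suc k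
[nCk*[1+n]]/[1+k]≡[1+n]C[1+k] n k = begin
    ((n C k) * suc n) / suc k
  ≡⟨ cong (_/ suc k) (*-comm (n C k) (suc n)) ⟩
    (suc n * (n C k)) / suc k
  ≡⟨ cong (_/ suc k) (sym ([1+k]*[1+n]C[1+k]≡[1+n]*nCk n k)) ⟩
    (suc k * (suc n C suc k)) / suc k
  ≡⟨ cong (_/ suc k) (*-comm (suc k) (suc n C suc k)) ⟩
    ((suc n C suc k) * suc k) / suc k
  ≡⟨ m*n/n≡m (suc n C suc k) (suc k) ⟩
    suc n C suc k ∎
  where open ≡-Reasoning

ccLoop-value : ∀ a r j → proj₁ (ccLoop a r j ((a + j) C j)) ≡ (a + (r + j)) C (r + j)
ccLoop-value a zero    j = refl
ccLoop-value a (suc r) j = begin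
    proj₁ (ccLoop a r (suc j) ((((a + j) C j) * (a + suc j)) / suc j))
  ≡⟨ cong (λ m → proj₁ (ccLoop a r (suc j) ((((a + j) C j) * m) / suc j))) (+-suc a j) ⟩
    proj₁ (ccLoop a r (suc j) ((((a + j) C j) * suc (a + j)) / suc j))
  ≡⟨ cong (λ c → proj₁ (ccLoop a r (suc j) c)) ([nCk*[1+n]]/[1+k]≡[1+n]C[1+k] (a + j) j) ⟩
    proj₁ (ccLoop a r (suc j) (suc (a + j) C suc j))
  ≡⟨ cong (λ m → proj₁ (ccLoop a r (suc j) (m C suc j))) (sym (+-suc a j)) ⟩
    proj₁ (ccLoop a r (suc j) ((a + suc j) C suc j))
  ≡⟨ ccLoop-value a r (suc j) ⟩
    (a + (r + suc j)) C (r + suc j)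
  ≡⟨ cong (λ m → (a + m) C m) (+-suc r j) ⟩
    (a + suc (r + j)) C suc (r + j) ∎
  where open ≡-Reasoning

CCc-value : ∀ a k → proj₁ (CCc a k) ≡ CC a k
CCc-value zero    zero    = refl
CCc-value zero    (suc k) = refl
CCc-value (suc a) k = trans (ccLoop-value a k zero) (cong (λ m → (a + m) C m) (+-identityʳ k))

ccLoop-cost : ∀ a r j c → proj₂ (ccLoop a r j c) ≡ 1 + r * 5
ccLoop-cost a zero    j c = refl
ccLoop-cost a (suc r) j c = cong (5 +_) (ccLoop-cost a r (suc j) _)

CCc-cost : ∀ a k → proj₂ (CCc a k) ≤ 2 + k * 5
CCc-cost zero    zero    = ≤-refl
CCc-cost zero    (suc k) = m≤m+n 2 _
CCc-cost (suc a) k = ≤-reflexive (cong suc (ccLoop-cost a k zero 1))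

module _ {a b p} {A : Set a} {B : Set b} {P : Pred B p} (P? : Decidable P) where

  filter-map : ∀ (f : A → B) xs → filter P? (map f xs) ≡ map f (filter (P? ∘ f) xs)
  filter-map f []       = refl
  filter-map f (x ∷ xs) with does (P? (f x))
  ... | true  = cong (f x ∷_) (filter-map f xs)
  ... | false = filter-map f xs

  filter-concatMap : ∀ (f : A → List B) xs → filter P? (concatMap f xs) ≡ concatMap (filter P? ∘ f) xs
  filter-concatMap f []       = refl
  filter-concatMap f (x ∷ xs) =
    trans (filter-++ P? (f x) (concatMap f xs)) (cong (filter P? (f x) ++_) (filter-concatMap f xs))

module _ {a p q} {A : Set a} {P : Pred A p} {Q : Pred A q} (P? : Decidable P) (Q? : Decidable Q) where

  filter-filter : ∀ xs → filter P? (filter Q? xs) ≡ filter (Q? ∩? P?) xs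
  filter-filter []       = refl
  filter-filter (x ∷ xs) with does (Q? x)
  ... | false = filter-filter xs
  ... | true with does (P? x)
  ...   | true  = cong (x ∷_) (filter-filter xs)
  ...   | false = filter-filter xs

module _ {a} {A : Set a} where

  concatMap-upTo-suc : ∀ (f : ℕ → List A) n → concatMap f (upTo (suc n)) ≡ concatMap f (upTo n) ++ f n
  concatMap-upTo-suc f n = begin
      concatMap f (upTo (suc n))
    ≡⟨ cong (concatMap f) (sym (upTo-∷ʳ n)) ⟩
      concatMap f (upTo n ++ [ n ])
    ≡⟨ concatMap-++ f (upTo n) [ n ] ⟩
      concatMap f (upTo n) ++ f n ++ []
    ≡⟨ cong (concatMap f (upTo n) ++_) (++-identityʳ (f n)) ⟩
      concatMap f (upTo n) ++ f n ∎
    where open ≡-Reasoning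

  concatMap-upTo-cong : ∀ {f g : ℕ → List A} n → (∀ {y} → y < n → f y ≡ g y) →
                        concatMap f (upTo n) ≡ concatMap g (upTo n)
  concatMap-upTo-cong         zero    _   = refl
  concatMap-upTo-cong {f} {g} (suc n) f≡g = begin
      concatMap f (upTo (suc n))
    ≡⟨ concatMap-upTo-suc f n ⟩
      concatMap f (upTo n) ++ f n
    ≡⟨ cong₂ _++_ (concatMap-upTo-cong n (f≡g ∘ m<n⇒m<1+n)) (f≡g (n<1+n n)) ⟩
      concatMap g (upTo n) ++ g n
    ≡⟨ concatMap-upTo-suc g n ⟨
      concatMap g (upTo (suc n)) ∎
    where open ≡-Reasoning

  concatMap-upTo-truncate : ∀ (f : ℕ → List A) {m n} → m ≤ n → (∀ {y} → m ≤ y → f y ≡ []) →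
                            concatMap f (upTo n) ≡ concatMap f (upTo m)
  concatMap-upTo-truncate f {m} m≤n f≡[] = go (≤⇒≤′ m≤n)
    where
      go : ∀ {n} → m ≤′ n → concatMap f (upTo n) ≡ concatMap f (upTo m)
      go ≤′-refl = refl
      go {suc n} (≤′-step m≤′n) = begin
          concatMap f (upTo (suc n))
        ≡⟨ concatMap-upTo-suc f n ⟩
          concatMap f (upTo n) ++ f n
        ≡⟨ cong (concatMap f (upTo n) ++_) (f≡[] (≤′⇒≤ m≤′n)) ⟩
          concatMap f (upTo n) ++ []
        ≡⟨ ++-identityʳ _ ⟩
          concatMap f (upTo n)
        ≡⟨ go m≤′n ⟩
          concatMap f (upTo m) ∎
        where open ≡-Reasoning

Linked≥-∷-≐ : ∀ y → (λ T → Linked _≥_ (y ∷ T)) ≐ (All (_< suc y) ∩ Linked _≥_)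
Linked≥-∷-≐ y = (λ y∷T → bounded y∷T , Linked.tail y∷T) , λ (T<1+y , T↓) → cons T<1+y T↓
  where
    bounded : ∀ {T} → Linked _≥_ (y ∷ T) → All (_< suc y) T
    bounded [-]         = []
    bounded (y≥z ∷ z∷T) = All.map s≤s (Linked⇒All (λ a≥b b≥c → ≤-trans b≥c a≥b) y≥z z∷T)
    cons : ∀ {T} → All (_< suc y) T → Linked _≥_ T → Linked _≥_ (y ∷ T)
    cons []          []  = [-]
    cons (z<1+y ∷ _) z∷T = ≤-pred z<1+y ∷ z∷T

filter-All<-allSeqs : ∀ {m n} → m ≤ n → ∀ k → filter (all? (_<? m)) (allSeqs n k) ≡ allSeqs m k
filter-All<-allSeqs m≤n zero = refl
filter-All<-allSeqs {m} {n} m≤n (suc k) = begin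
    filter <m? (concatMap (λ y → map (y ∷_) (allSeqs n k)) (upTo n))
  ≡⟨ filter-concatMap <m? _ (upTo n) ⟩
    concatMap (λ y → filter <m? (map (y ∷_) (allSeqs n k))) (upTo n)
  ≡⟨ concatMap-upTo-truncate _ m≤n none ⟩
    concatMap (λ y → filter <m? (map (y ∷_) (allSeqs n k))) (upTo m)
  ≡⟨ concatMap-upTo-cong m tails ⟩
    concatMap (λ y → map (y ∷_) (allSeqs m k)) (upTo m) ∎
  where
    open ≡-Reasoning
    <m? = all? (_<? m)
    none : ∀ {y} → m ≤ y → filter <m? (map (y ∷_) (allSeqs n k)) ≡ []
    none {y} m≤y = trans (filter-map <m? (y ∷_) (allSeqs n k)) (cong (map (y ∷_))
      (filter-none (<m? ∘ (y ∷_)) (universal (λ { _ (y<m ∷ _) → <⇒≱ y<m m≤y }) (allSeqs n k))))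
    tails : ∀ {y} → y < m → filter <m? (map (y ∷_) (allSeqs n k)) ≡ map (y ∷_) (allSeqs m k)
    tails {y} y<m = trans (filter-map <m? (y ∷_) (allSeqs n k)) (cong (map (y ∷_))
      (trans (filter-≐ (<m? ∘ (y ∷_)) <m? (All.tail , (y<m ∷_)) (allSeqs n k)) (filter-All<-allSeqs m≤n k)))

multisets-suc : ∀ n k → multisets n (suc k) ≡ concatMap (λ y → map (y ∷_) (multisets (suc y) k)) (upTo n)
multisets-suc n k = begin
    filter ↓? (concatMap (λ y → map (y ∷_) (allSeqs n k)) (upTo n))
  ≡⟨ filter-concatMap ↓? _ (upTo n) ⟩
    concatMap (λ y → filter ↓? (map (y ∷_) (allSeqs n k))) (upTo n)
  ≡⟨ concatMap-upTo-cong n filtered-block ⟩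
    concatMap (λ y → map (y ∷_) (multisets (suc y) k)) (upTo n) ∎
  where
    open ≡-Reasoning
    ↓? = linked? _≥?_
    filtered-block : ∀ {y} → y < n → filter ↓? (map (y ∷_) (allSeqs n k)) ≡ map (y ∷_) (multisets (suc y) k)
    filtered-block {y} y<n = begin
        filter ↓? (map (y ∷_) (allSeqs n k))
      ≡⟨ filter-map ↓? (y ∷_) (allSeqs n k) ⟩
        map (y ∷_) (filter (↓? ∘ (y ∷_)) (allSeqs n k))
      ≡⟨ cong (map (y ∷_)) (filter-≐ (↓? ∘ (y ∷_)) (<1+y? ∩? ↓?) (Linked≥-∷-≐ y) (allSeqs n k)) ⟩
        map (y ∷_) (filter (<1+y? ∩? ↓?) (allSeqs n k))
      ≡⟨ cong (map (y ∷_)) (filter-filter ↓? <1+y? (allSeqs n k)) ⟨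
        map (y ∷_) (filter ↓? (filter <1+y? (allSeqs n k)))
      ≡⟨ cong (map (y ∷_) ∘ filter ↓?) (filter-All<-allSeqs y<n k) ⟩
        map (y ∷_) (multisets (suc y) k) ∎
      where <1+y? = all? (_<? suc y)

multisets-suc-suc : ∀ n k → multisets (suc n) (suc k) ≡ multisets n (suc k) ++ map (n ∷_) (multisets (suc n) k)
multisets-suc-suc n k = begin
    multisets (suc n) (suc k)
  ≡⟨ multisets-suc (suc n) k ⟩
    concatMap block (upTo (suc n))
  ≡⟨ concatMap-upTo-suc block n ⟩
    concatMap block (upTo n) ++ block n
  ≡⟨ cong (_++ block n) (multisets-suc n k) ⟨
    multisets n (suc k) ++ map (n ∷_) (multisets (suc n) k) ∎
  where
    open ≡-Reasoning
    block = λ y → map (y ∷_) (multisets (suc y) k)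

length-multisets : ∀ n k → length (multisets n k) ≡ CC n k
length-multisets zero    zero    = refl
length-multisets (suc n) zero    = refl
length-multisets zero    (suc k) = refl
length-multisets (suc n) (suc k) = begin
    length (multisets (suc n) (suc k))
  ≡⟨ cong length (multisets-suc-suc n k) ⟩
    length (multisets n (suc k) ++ map (n ∷_) (multisets (suc n) k))
  ≡⟨ length-++ (multisets n (suc k)) ⟩
    length (multisets n (suc k)) + length (map (n ∷_) (multisets (suc n) k))
  ≡⟨ cong₂ _+_ (length-multisets n (suc k)) (trans (length-map (n ∷_) (multisets (suc n) k)) (length-multisets (suc n) k)) ⟩
    CC n (suc k) + CC (suc n) k
  ≡⟨ CC-pascal n k ⟨
    CC (suc n) (suc k) ∎
  where open ≡-Reasoning

x∷-<lex-x∷-≐ : ∀ x S → (λ T → (x ∷ T) <lex (x ∷ S)) ≐ (_<lex S)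
x∷-<lex-x∷-≐ x S = (λ { (this x<x) → contradiction x<x (n≮n x) ; (next _ T<S) → T<S }) , next refl

filter-<lex-∷-multisets : ∀ {x n} k S → x < n →
  filter (_<lex? (x ∷ S)) (multisets n (suc k)) ≡
  multisets x (suc k) ++ map (x ∷_) (filter (_<lex? S) (multisets (suc x) k))
filter-<lex-∷-multisets {x} {n} k S x<n = begin
    filter <x∷S? (multisets n (suc k))
  ≡⟨ cong (filter <x∷S?) (multisets-suc n k) ⟩
    filter <x∷S? (concatMap block (upTo n))
  ≡⟨ filter-concatMap <x∷S? block (upTo n) ⟩
    concatMap (filter <x∷S? ∘ block) (upTo n)
  ≡⟨ concatMap-upTo-truncate (filter <x∷S? ∘ block) x<n above ⟩
    concatMap (filter <x∷S? ∘ block) (upTo (suc x))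
  ≡⟨ concatMap-upTo-suc (filter <x∷S? ∘ block) x ⟩
    concatMap (filter <x∷S? ∘ block) (upTo x) ++ filter <x∷S? (block x)
  ≡⟨ cong₂ _++_ (concatMap-upTo-cong x below) at ⟩
    concatMap block (upTo x) ++ map (x ∷_) (filter (_<lex? S) (multisets (suc x) k))
  ≡⟨ cong (_++ map (x ∷_) (filter (_<lex? S) (multisets (suc x) k))) (multisets-suc x k) ⟨
    multisets x (suc k) ++ map (x ∷_) (filter (_<lex? S) (multisets (suc x) k)) ∎
  where
    open ≡-Reasoning
    <x∷S? = _<lex? (x ∷ S)
    block = λ y → map (y ∷_) (multisets (suc y) k)
    above : ∀ {y} → suc x ≤ y → filter <x∷S? (block y) ≡ []
    above {y} x<y = trans (filter-map <x∷S? (y ∷_) (multisets (suc y) k))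
      (cong (map (y ∷_)) (filter-none (<x∷S? ∘ (y ∷_))
        (universal (λ { _ (this y<x) → <-asym x<y y<x ; _ (next refl _) → n≮n x x<y }) (multisets (suc y) k))))
    below : ∀ {y} → y < x → filter <x∷S? (block y) ≡ block y
    below {y} y<x = trans (filter-map <x∷S? (y ∷_) (multisets (suc y) k))
      (cong (map (y ∷_)) (filter-all (<x∷S? ∘ (y ∷_)) (universal (λ _ → this y<x) (multisets (suc y) k))))
    at : filter <x∷S? (block x) ≡ map (x ∷_) (filter (_<lex? S) (multisets (suc x) k))
    at = trans (filter-map <x∷S? (x ∷_) (multisets (suc x) k))
      (cong (map (x ∷_)) (filter-≐ (<x∷S? ∘ (x ∷_)) (_<lex? S) (x∷-<lex-x∷-≐ x S) (multisets (suc x) k)))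

index-∷ : ∀ {x n} k S → x < n → index n (suc k) (x ∷ S) ≡ CC x (suc k) + index (suc x) k S
index-∷ {x} {n} k S x<n = begin
    length (filter (_<lex? (x ∷ S)) (multisets n (suc k)))
  ≡⟨ cong length (filter-<lex-∷-multisets k S x<n) ⟩
    length (multisets x (suc k) ++ map (x ∷_) smaller)
  ≡⟨ length-++ (multisets x (suc k)) ⟩
    length (multisets x (suc k)) + length (map (x ∷_) smaller)
  ≡⟨ cong₂ _+_ (length-multisets x (suc k)) (length-map (x ∷_) smaller) ⟩
    CC x (suc k) + index (suc x) k S ∎
  where
    open ≡-Reasoning
    smaller = filter (_<lex? S) (multisets (suc x) k)

IsMultiset-∷ : ∀ {ℓ n k R} → ℓ < n → IsMultiset (suc ℓ) k R → IsMultiset n (suc k) (ℓ ∷ R)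
IsMultiset-∷ {ℓ} ℓ<n (∣R∣≡k , R<1+ℓ , R↓) =
  cong suc ∣R∣≡k , ℓ<n ∷ All.map (λ z<1+ℓ → <-≤-trans z<1+ℓ ℓ<n) R<1+ℓ , proj₂ (Linked≥-∷-≐ ℓ) (R<1+ℓ , R↓)

n/2≡⌊n/2⌋ : ∀ n → n / 2 ≡ ⌊ n /2⌋
n/2≡⌊n/2⌋ zero          = refl
n/2≡⌊n/2⌋ (suc zero)    = refl
n/2≡⌊n/2⌋ (suc (suc n)) = trans (m/n≡1+[m∸n]/n {suc (suc n)} {2} (s≤s (s≤s z≤n))) (cong suc (n/2≡⌊n/2⌋ n))

⌊m+[m+n]/2⌋≡m+⌊n/2⌋ : ∀ m n → ⌊ m + (m + n) /2⌋ ≡ m + ⌊ n /2⌋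
⌊m+[m+n]/2⌋≡m+⌊n/2⌋ zero    n = refl
⌊m+[m+n]/2⌋≡m+⌊n/2⌋ (suc m) n =
  trans (cong (λ k → ⌊ suc k /2⌋) (+-suc m (m + n))) (cong suc (⌊m+[m+n]/2⌋≡m+⌊n/2⌋ m n))

record Bisection (lo hi mid : ℕ) : Set where
  field
    lo<mid     : lo < mid
    mid<hi     : mid < hi
    left-half  : mid ∸ lo ≤ ⌈ (hi ∸ lo) /2⌉
    right-half : hi ∸ mid ≤ ⌈ (hi ∸ lo) /2⌉

open Bisection

midpoint-bisection : ∀ lo hi → 2 ≤ hi ∸ lo → Bisection lo hi ((lo + hi) / 2)
midpoint-bisection lo hi 2≤hi∸lo with m≤n⇒∃[o]m+o≡n (<⇒≤ (m∸n≢0⇒n<m {hi} {lo} hi∸lo≢0))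
  where
    hi∸lo≢0 : hi ∸ lo ≢ 0
    hi∸lo≢0 hi∸lo≡0 = <⇒≱ (subst (1 <_) hi∸lo≡0 2≤hi∸lo) z≤n
... | d , refl = subst (Bisection lo (lo + d)) (sym mid≡) (shifted d (subst (2 ≤_) (m+n∸m≡n lo d) 2≤hi∸lo))
  where
    mid≡ : (lo + (lo + d)) / 2 ≡ lo + ⌊ d /2⌋
    mid≡ = trans (n/2≡⌊n/2⌋ (lo + (lo + d))) (⌊m+[m+n]/2⌋≡m+⌊n/2⌋ lo d)
    shifted : ∀ d → 2 ≤ d → Bisection lo (lo + d) (lo + ⌊ d /2⌋)
    shifted (suc zero) (s≤s ())
    shifted d@(suc (suc e)) _ = record
      { lo<mid     = m<m+n lo z<s
      ; mid<hi     = +-monoʳ-< lo (⌊n/2⌋<n (suc e))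
      ; left-half  = subst₂ (λ a b → a ≤ ⌈ b /2⌉) (sym (m+n∸m≡n lo h)) (sym (m+n∸m≡n lo d)) (⌊n/2⌋≤⌈n/2⌉ d)
      ; right-half = ≤-reflexive (begin
          lo + d ∸ (lo + h)  ≡⟨ [m+n]∸[m+o]≡n∸o lo d h ⟩
          d ∸ h              ≡⟨ cong (_∸ h) (⌊n/2⌋+⌈n/2⌉≡n d) ⟨
          h + ⌈ d /2⌉ ∸ h    ≡⟨ m+n∸m≡n h ⌈ d /2⌉ ⟩
          ⌈ d /2⌉            ≡⟨ cong ⌈_/2⌉ (m+n∸m≡n lo d) ⟨
          ⌈ lo + d ∸ lo /2⌉  ∎)
      }
      where
        open ≡-Reasoning
        h = ⌊ d /2⌋

m≤⌈n/2⌉⇒⌈log₂m⌉<⌈log₂n⌉ : ∀ {m n} → 2 ≤ n → m ≤ ⌈ n /2⌉ → ⌈log₂ m ⌉ < ⌈log₂ n ⌉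
m≤⌈n/2⌉⇒⌈log₂m⌉<⌈log₂n⌉ {m} {n} 2≤n m≤⌈n/2⌉ = begin-strict
    ⌈log₂ m ⌉          ≤⟨ ⌈log₂⌉-mono-≤ m≤⌈n/2⌉ ⟩
    ⌈log₂ ⌈ n /2⌉ ⌉    ≡⟨ ⌈log₂⌈n/2⌉⌉≡⌈log₂n⌉∸1 n ⟩
    ⌈log₂ n ⌉ ∸ 1      <⟨ ∸-monoʳ-< z<s (⌈log₂⌉-mono-≤ 2≤n) ⟩
    ⌈log₂ n ⌉          ∎
  where open ≤-Reasoning


bsearch-< : ∀ f K i {lo hi} → lo < hi → proj₁ (bsearch f K i lo hi) < hi
bsearch-< zero    K i         lo<hi = lo<hi
bsearch-< (suc f) K i {lo} {hi} lo<hi with (hi ∸ lo) ≤ᵇ 1 | ≤ᵇ-reflects-≤ (hi ∸ lo) 1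
... | true  | _         = lo<hi
... | false | ofⁿ gap≰1 with midpoint-bisection lo hi (≰⇒> gap≰1) | proj₁ (CCc ((lo + hi) / 2) K) ≤ᵇ i
...   | bisect | true  = bsearch-< f K i (mid<hi bisect)
...   | bisect | false = <-trans (bsearch-< f K i (lo<mid bisect)) (mid<hi bisect)

bsearch-brackets : ∀ f K i {lo hi} → lo < hi → hi ∸ lo ≤ f → CC lo K ≤ i → i < CC hi K →
                   let ℓ = proj₁ (bsearch f K i lo hi) in CC ℓ K ≤ i × i < CC (suc ℓ) K
bsearch-brackets zero    K i lo<hi gap≤0 _ _ = contradiction gap≤0 (<⇒≱ (m<n⇒0<n∸m lo<hi))
bsearch-brackets (suc f) K i {lo} {hi} lo<hi gap≤1+f CClo≤i i<CChi
  with (hi ∸ lo) ≤ᵇ 1 | ≤ᵇ-reflects-≤ (hi ∸ lo) 1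
... | true  | ofʸ gap≤1 = CClo≤i , subst (λ h → i < CC h K) hi≡1+lo i<CChi
  where
    hi≡1+lo : hi ≡ suc lo
    hi≡1+lo = trans (sym (m+[n∸m]≡n (<⇒≤ lo<hi)))
                (trans (cong (lo +_) (≤-antisym gap≤1 (m<n⇒0<n∸m lo<hi))) (+-comm lo 1))
... | false | ofⁿ gap≰1 with midpoint-bisection lo hi (≰⇒> gap≰1)
                           | proj₁ (CCc ((lo + hi) / 2) K) ≤ᵇ i | ≤ᵇ-reflects-≤ (proj₁ (CCc ((lo + hi) / 2) K)) i
...   | bisect | true  | ofʸ CCmid≤i =
  bsearch-brackets f K i (mid<hi bisect)
    (≤-pred (≤-trans (∸-monoʳ-< (lo<mid bisect) (<⇒≤ (mid<hi bisect))) gap≤1+f))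
    (subst (_≤ i) (CCc-value ((lo + hi) / 2) K) CCmid≤i) i<CChi
...   | bisect | false | ofⁿ CCmid≰i =
  bsearch-brackets f K i (lo<mid bisect)
    (≤-pred (≤-trans (∸-monoˡ-< (mid<hi bisect) (<⇒≤ (lo<mid bisect))) gap≤1+f))
    CClo≤i (≰⇒> (CCmid≰i ∘ subst (_≤ i) (sym (CCc-value ((lo + hi) / 2) K))))

bisection-step-cost : ∀ K {c r L′ L} → c ≤ 2 + K * 5 → r ≤ 2 + (7 + K * 5) * L′ → L′ < L →
                      2 + 2 + c + 1 + r ≤ 2 + (7 + K * 5) * L
bisection-step-cost K {c} {r} {L′} {L} c≤ r≤ L′<L = begin
    2 + 2 + c + 1 + r
  ≤⟨ +-mono-≤ (+-monoˡ-≤ 1 (+-monoʳ-≤ 4 c≤)) r≤ ⟩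
    2 + 2 + (2 + K * 5) + 1 + (2 + (7 + K * 5) * L′)
  ≡⟨ rearrange K L′ ⟩
    2 + (7 + K * 5) * suc L′
  ≤⟨ +-monoʳ-≤ 2 (*-monoʳ-≤ (7 + K * 5) L′<L) ⟩
    2 + (7 + K * 5) * L ∎
  where
    open ≤-Reasoning
    rearrange : ∀ K L′ → 2 + 2 + (2 + K * 5) + 1 + (2 + (7 + K * 5) * L′) ≡ 2 + (7 + K * 5) * suc L′
    rearrange = solve-∀

bsearch-cost : ∀ f K i lo hi → proj₂ (bsearch f K i lo hi) ≤ 2 + (7 + K * 5) * ⌈log₂ (hi ∸ lo) ⌉
bsearch-cost zero    K i lo hi = s≤s z≤n
bsearch-cost (suc f) K i lo hi with (hi ∸ lo) ≤ᵇ 1 | ≤ᵇ-reflects-≤ (hi ∸ lo) 1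
... | true  | _         = m≤m+n 2 _
... | false | ofⁿ gap≰1 with midpoint-bisection lo hi (≰⇒> gap≰1) | proj₁ (CCc ((lo + hi) / 2) K) ≤ᵇ i
...   | bisect | true  = bisection-step-cost K (CCc-cost ((lo + hi) / 2) K) (bsearch-cost f K i ((lo + hi) / 2) hi)
                           (m≤⌈n/2⌉⇒⌈log₂m⌉<⌈log₂n⌉ (≰⇒> gap≰1) (right-half bisect))
...   | bisect | false = bisection-step-cost K (CCc-cost ((lo + hi) / 2) K) (bsearch-cost f K i lo ((lo + hi) / 2))
                           (m≤⌈n/2⌉⇒⌈log₂m⌉<⌈log₂n⌉ (≰⇒> gap≰1) (left-half bisect))

IthMultiset : (n k i : ℕ) → List ℕ → Set
IthMultiset n k i S = IsMultiset n k S × index n k S ≡ i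

IthMultiset-∷ : ∀ {ℓ n k i R} → ℓ < n → CC ℓ (suc k) ≤ i →
                IthMultiset (suc ℓ) k (i ∸ CC ℓ (suc k)) R → IthMultiset n (suc k) i (ℓ ∷ R)
IthMultiset-∷ {ℓ} {n} {k} {i} {R} ℓ<n CCℓ≤i (R-multiset , R-index) = IsMultiset-∷ ℓ<n R-multiset , (begin
    index n (suc k) (ℓ ∷ R)              ≡⟨ index-∷ k R ℓ<n ⟩
    CC ℓ (suc k) + index (suc ℓ) k R     ≡⟨ cong (CC ℓ (suc k) +_) R-index ⟩
    CC ℓ (suc k) + (i ∸ CC ℓ (suc k))    ≡⟨ m+[n∸m]≡n CCℓ≤i ⟩
    i                                    ∎)
  where open ≡-Reasoning

CC-bracket-offset< : ∀ {ℓ k i} → CC ℓ (suc k) ≤ i → i < CC (suc ℓ) (suc k) → i ∸ CC ℓ (suc k) < CC (suc ℓ) k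
CC-bracket-offset< {ℓ} {k} {i} CCℓ≤i i<CC[1+ℓ] =
  subst (i ∸ CC ℓ (suc k) <_) (m+n∸m≡n (CC ℓ (suc k)) (CC (suc ℓ) k))
    (∸-monoˡ-< (subst (i <_) (CC-pascal ℓ k) i<CC[1+ℓ]) CCℓ≤i)

replicate-IthMultiset : ∀ k → IthMultiset 1 k 0 (replicate k 0)
replicate-IthMultiset zero    = (refl , [] , []) , refl
replicate-IthMultiset (suc k) = IthMultiset-∷ z<s z≤n (replicate-IthMultiset k)

FindMultiset-correct : ∀ n k i → 1 ≤ n → i < CC n k → IthMultiset n k i (FindMultiset n k i)
FindMultiset-correct (suc n) zero zero    _ _        = (refl , [] , []) , refl
FindMultiset-correct (suc n) zero (suc i) _ (s≤s ())
FindMultiset-correct 1 (suc k) i _ i<CC rewrite n<1⇒n≡0 (subst (i <_) (nCn≡1 (suc k)) i<CC) =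
  replicate-IthMultiset (suc k)
FindMultiset-correct n@(suc (suc _)) (suc k) i _ i<CC =
  IthMultiset-∷ ℓ<n CCℓ≤i (subst (λ c → IthMultiset (suc ℓ) k (i ∸ c) R) (CCc-value ℓ (suc k)) R-correct)
  where
    ℓ = proj₁ (bsearch n (suc k) i 0 n)
    ℓ<n = bsearch-< n (suc k) i z<s
    brackets = bsearch-brackets n (suc k) i z<s ≤-refl z≤n i<CC
    CCℓ≤i = proj₁ brackets
    i′ = i ∸ proj₁ (CCc ℓ (suc k))
    i′<CC : i′ < CC (suc ℓ) k
    i′<CC = subst (λ c → i ∸ c < CC (suc ℓ) k) (sym (CCc-value ℓ (suc k)))
              (CC-bracket-offset< {ℓ} CCℓ≤i (proj₂ brackets))
    R = FindMultiset (suc ℓ) k i′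
    R-correct = FindMultiset-correct (suc ℓ) k i′ (s≤s z≤n) i′<CC

FindMultiset-step-cost : ∀ k {L} → 1 ≤ L →
  2 + (2 + (7 + suc k * 5) * L) + (2 + suc k * 5) + 1 + (2 + 30 * (k * k * L)) ≤ 2 + 30 * (suc k * suc k * L)
FindMultiset-step-cost k {suc L} _ = ≤-trans (m≤m+n _ _) (≤-reflexive (slack k L))
  where
    slack : ∀ k L → 2 + (2 + (7 + suc k * 5) * suc L) + (2 + suc k * 5) + 1 + (2 + 30 * (k * k * suc L))
                      + (6 + 50 * k + 55 * k * L + 18 * L)
                    ≡ 2 + 30 * (suc k * suc k * suc L)
    slack = solve-∀

steps-≤ : ∀ n k i → 1 ≤ n → steps n k i ≤ 2 + 30 * (k * k * ⌈log₂ n ⌉)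
steps-≤ (suc n) zero    i _ = m≤m+n 2 _
steps-≤ 1       (suc k) i _ = m≤m+n 2 _
steps-≤ n@(suc (suc _)) (suc k) i _ = begin
    2 + proj₂ (bsearch n (suc k) i 0 n) + proj₂ (CCc ℓ (suc k)) + 1 + steps (suc ℓ) k i′
  ≤⟨ +-mono-≤ (+-monoˡ-≤ 1 (+-mono-≤ (+-monoʳ-≤ 2 (bsearch-cost n (suc k) i 0 n)) (CCc-cost ℓ (suc k)))) rest ⟩
    2 + (2 + (7 + suc k * 5) * ⌈log₂ n ⌉) + (2 + suc k * 5) + 1 + (2 + 30 * (k * k * ⌈log₂ n ⌉))
  ≤⟨ FindMultiset-step-cost k (⌈log₂⌉-mono-≤ {2} {n} (s≤s (s≤s z≤n))) ⟩
    2 + 30 * (suc k * suc k * ⌈log₂ n ⌉) ∎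
  where
    open ≤-Reasoning
    ℓ = proj₁ (bsearch n (suc k) i 0 n)
    i′ = i ∸ proj₁ (CCc ℓ (suc k))
    rest : steps (suc ℓ) k i′ ≤ 2 + 30 * (k * k * ⌈log₂ n ⌉)
    rest = ≤-trans (steps-≤ (suc ℓ) k i′ (s≤s z≤n))
             (+-monoʳ-≤ 2 (*-monoʳ-≤ 30 (*-monoʳ-≤ (k * k) (⌈log₂⌉-mono-≤ {suc ℓ} {n} (bsearch-< n (suc k) i z<s)))))

lemma1 : ((n k i : ℕ) → 1 ≤ n → i < CC n k →
    IsMultiset n k (FindMultiset n k i) × index n k (FindMultiset n k i) ≡ i)
    × Σ ℕ (λ c → (n k i : ℕ) → 1 ≤ n → i < CC n k →
    steps n k i ≤ c * (1 + k * k * ⌈log₂ n ⌉))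
lemma1 = FindMultiset-correct , 32 , λ n k i 1≤n _ → ≤-trans (steps-≤ n k i 1≤n) (2+30*x≤32*[1+x] (k * k * ⌈log₂ n ⌉))
  where
    regroup : ∀ x → 2 + 30 * x + (30 + 2 * x) ≡ 32 * (1 + x)
    regroup = solve-∀
    2+30*x≤32*[1+x] : ∀ x → 2 + 30 * x ≤ 32 * (1 + x)
    2+30*x≤32*[1+x] x = ≤-trans (m≤m+n (2 + 30 * x) (30 + 2 * x)) (≤-reflexive (regroup x))
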